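{- Let $(\mathcal W,\rhd)$ be a $\lambda\mathbf{A}$-frame and $\eta$ a hereditary type environment. If $A\simeq B$, then $\mathcal I(A)^\eta_p=\mathcal I(B)^\eta_p$ for every $p\in\mathcal W$.
   Context: Type expressions. Pseudo type expressions: $A::=X\mid A\to B\mid \bullet A\mid \mu X.A$ over a countable set of type variables ($\alpha$-equivalent ones identified; $A[B/X]$ capture-avoiding substitution). $\top:=\mu X.\bullet X$. Tail: $t(X)=X$, $t(A\to B)=t(B)$, $t(\bullet A)=\bullet t(A)$, $t(\mu X.A)=\mu X.t(A)$. $A$ is a $\top$-variant iff $t(A)=\bullet^{m_0}\mu X_1.\bullet^{m_1}\cdots\mu X_n.\bullet^{m_n}X_i$ with $1\le i\le n$, $X_i\notin\{X_{i+1},\dots,X_n\}$, $m_i+\dots+m_n\ge1$. Properness in $X$: variable $Y$ iff $Y\neq X$; $\bullet A$ always; $A\to B$ iff both $A,B$ are proper or $B$ is a $\top$-variant; $\mu Y.A$ ($Y\ne X$) iff $A$ is proper or $\mu Y.A$ is a $\top$-variant. Type expressions: pseudo type expressions in which every $\mu X.A$ has $A$ proper in $X$. Equality $\simeq$: the smallest relation on type expressions closed under: reflexivity, symmetry, transitivity; $A\simeq B\Rightarrow\bullet A\simeq\bullet B$; $A\simeq C,B\simeq D\Rightarrow A\to B\simeq C\to D$; $A\to\top\simeq\top$; $\mu X.A\simeq A[\mu X.A/X]$; if $A\simeq C[A/X]$ and $C$ proper in $X$ then $A\simeq\mu X.C$; and $\bullet(A\to B)\simeq\bullet A\to\bullet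 B$. Semantics. Fix a syntactical $\lambda$-algebra $(\mathcal V,\cdot,[\![\,]\!])$ ($[\![x]\!]_\rho=\rho(x)$, $[\![MN]\!]_\rho=[\![M]\!]_\rho\cdot[\![N]\!]_\rho$, $[\![\lambda x.M]\!]_\rho\cdot v=[\![M]\!]_{\rho[v/x]}$, dependence only on free variables, invariance under $=_\beta$). A $\lambda\mathbf A$-frame $(\mathcal W,\rhd)$: nonempty $\mathcal W$, no infinite chain $p_0\rhd p_1\rhd\cdots$, and local linearity: with $\unrhd^*$ the reflexive transitive closure of $\rhd$, whenever $p\rhd q$ there is $r$ with $p\unrhd^* r\rhd q$ such that $r\rhd s$ implies $q\unrhd^* s$ for all $s$. A hereditary type environment gives $\eta(X)_p\subseteq\mathcal V$ with $p\rhd q\Rightarrow\eta(X)_p\subseteq\eta(X)_q$. Interpretation: $\mathcal I(A)^\eta_p=\mathcal V$ if $A$ is a $\top$-variant; otherwise $\mathcal I(X)^\eta_p=\eta(X)_p$; $\mathcal I(\bullet A)^\eta_p=\{u\mid\forall q\,(p\rhd q\Rightarrow u\in\mathcal I(A)^\eta_q)\}$; $\mathcal I(A\to B)^\eta_p=\{u\mid\forall q\,(p\unrhd^* q)\,\forall v\in\mathcal I(A)^\eta_q: u\cdot v\in\mathcal I(B)^\eta_q\}$; $\mathcal I(\mu X.A)^\eta_p=\mathcal I(A[\mu X.A/X])^\eta_p$. -}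

module Defs where

open import Level using (0ℓ)
open import Data.Nat using (ℕ; zero; suc)
open import Data.Bool using (Bool; true; false)
open import Data.List using (List; []; _∷_; map)
open import Data.Product using (Σ; ∃; _×_; _,_)
open import Data.Sum using (_⊎_)
open import Data.Unit using (⊤)
open import Function using (flip; const)
open import Relation.Nullary using (¬_)
open import Relation.Binary.PropositionalEquality using (_≡_)
open import Relation.Binary.Construct.Closure.ReflexiveTransitive using (Star)
open import Induction.WellFounded using (WellFounded)
open import Relation.Unary using (Pred; _∈_; _⊆_; _≐_; U)

infixl 7 _·_
data Tm : Set where
  `_  : ℕ → Tm
  _·_ : Tm → Tm → Tm
  ƛ_  : Tm → Tm

ext : (ℕ → ℕ) → ℕ → ℕ
ext ρ zero    = zero
ext ρ (suc n) = suc (ρ n)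

renTm : (ℕ → ℕ) → Tm → Tm
renTm ρ (` x)   = ` ρ x
renTm ρ (M · N) = renTm ρ M · renTm ρ N
renTm ρ (ƛ M)   = ƛ renTm (ext ρ) M

extsTm : (ℕ → Tm) → ℕ → Tm
extsTm σ zero    = ` zero
extsTm σ (suc n) = renTm suc (σ n)

substTm : (ℕ → Tm) → Tm → Tm
substTm σ (` x)   = σ x
substTm σ (M · N) = substTm σ M · substTm σ N
substTm σ (ƛ M)   = ƛ substTm (extsTm σ) M

σ₀Tm : Tm → ℕ → Tm
σ₀Tm N zero    = N
σ₀Tm N (suc n) = ` n

-- M [ N ]ᵗ : substitute N for the variable bound by the outer λ of ƛ M
_[_]ᵗ : Tm → Tm → Tm
M [ N ]ᵗ = substTm (σ₀Tm N) M

infix 4 _=β_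
data _=β_ : Tm → Tm → Set where
  β      : ∀ {M N} → (ƛ M) · N =β M [ N ]ᵗ
  β-refl : ∀ {M} → M =β M
  β-sym  : ∀ {M N} → M =β N → N =β M
  β-trans : ∀ {M N P} → M =β N → N =β P → M =β P
  β-app  : ∀ {M M′ N N′} → M =β M′ → N =β N′ → M · N =β M′ · N′
  β-lam  : ∀ {M M′} → M =β M′ → ƛ M =β ƛ M′

data FreeIn : ℕ → Tm → Set where
  fv-var  : ∀ {x} → FreeIn x (` x)
  fv-appˡ : ∀ {x M N} → FreeIn x M → FreeIn x (M · N)
  fv-appʳ : ∀ {x M N} → FreeIn x N → FreeIn x (M · N)
  fv-lam  : ∀ {x M} → FreeIn (suc x) M → FreeIn x (ƛ M)

_∷ᵉ_ : {V : Set} → V → (ℕ → V) → ℕ → V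
(v ∷ᵉ ρ) zero    = v
(v ∷ᵉ ρ) (suc n) = ρ n

record SynLamAlg : Set₁ where
  infixl 7 _∙_
  field
    V     : Set
    _∙_   : V → V → V
    ⟦_⟧   : Tm → (ℕ → V) → V
    ⟦var⟧ : ∀ x ρ → ⟦ ` x ⟧ ρ ≡ ρ x
    ⟦app⟧ : ∀ M N ρ → ⟦ M · N ⟧ ρ ≡ ⟦ M ⟧ ρ ∙ ⟦ N ⟧ ρ
    ⟦lam⟧ : ∀ M ρ v → ⟦ ƛ M ⟧ ρ ∙ v ≡ ⟦ M ⟧ (v ∷ᵉ ρ)
    ⟦fv⟧  : ∀ M ρ ρ′ → (∀ x → FreeIn x M → ρ x ≡ ρ′ x) → ⟦ M ⟧ ρ ≡ ⟦ M ⟧ ρ′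
    ⟦β⟧   : ∀ {M N} ρ → M =β N → ⟦ M ⟧ ρ ≡ ⟦ N ⟧ ρ

-- Pseudo type expressions (de Bruijn; α-equivalent ones are identical)

infixr 5 _⇒_
data Ty : Set where
  tvar : ℕ → Ty
  _⇒_  : Ty → Ty → Ty
  ●_   : Ty → Ty
  μ_   : Ty → Ty

ren : (ℕ → ℕ) → Ty → Ty
ren ρ (tvar x) = tvar (ρ x)
ren ρ (A ⇒ B)  = ren ρ A ⇒ ren ρ B
ren ρ (● A)    = ● ren ρ A
ren ρ (μ A)    = μ ren (ext ρ) A

exts : (ℕ → Ty) → ℕ → Ty
exts σ zero    = tvar zero
exts σ (suc n) = ren suc (σ n)

subst : (ℕ → Ty) → Ty → Ty
subst σ (tvar x) = σ x
subst σ (A ⇒ B)  = subst σ A ⇒ subst σ B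
subst σ (● A)    = ● subst σ A
subst σ (μ A)    = μ subst (exts σ) A

σ₀ : Ty → ℕ → Ty
σ₀ B zero    = B
σ₀ B (suc n) = tvar n

-- A [ B ]₀ : for a body A of a binder μX.A, this is A[B/X]
_[_]₀ : Ty → Ty → Ty
A [ B ]₀ = subst (σ₀ B) A

𝕋 : Ty
𝕋 = μ (● tvar zero)

tail : Ty → Ty
tail (tvar x) = tvar x
tail (A ⇒ B)  = tail B
tail (● A)    = ● tail A
tail (μ A)    = μ tail A

-- Shape •^{m0} μX1 •^{m1} ⋯ μXn •^{mn} Xi with Xi bound by μXi
-- (Xi ∉ {X_{i+1},…,Xn}) and m_i+⋯+m_n ≥ 1.  The list records, for
-- each enclosing μ (innermost first), whether some • occurred after it.
data Marked : List Bool → ℕ → Set where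
  here  : ∀ {bs} → Marked (true ∷ bs) zero
  there : ∀ {b bs k} → Marked bs k → Marked (b ∷ bs) (suc k)

data TopShape : List Bool → Ty → Set where
  ts-var : ∀ {bs k} → Marked bs k → TopShape bs (tvar k)
  ts-●   : ∀ {bs A} → TopShape (map (const true) bs) A → TopShape bs (● A)
  ts-μ   : ∀ {bs A} → TopShape (false ∷ bs) A → TopShape bs (μ A)

IsTopVariant : Ty → Set
IsTopVariant A = TopShape [] (tail A)

Proper : ℕ → Ty → Set
Proper x (tvar y) = ¬ (y ≡ x)
Proper x (● A)    = ⊤
Proper x (A ⇒ B)  = (Proper x A × Proper x B) ⊎ IsTopVariant B
Proper x (μ A)    = Proper (suc x) A ⊎ IsTopVariant (μ A)

WF : Ty → Set
WF (tvar x) = ⊤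
WF (A ⇒ B)  = WF A × WF B
WF (● A)    = WF A
WF (μ A)    = Proper zero A × WF A

infix 4 _≃_
data _≃_ : Ty → Ty → Set where
  ≃-refl  : ∀ {A} → WF A → A ≃ A
  ≃-sym   : ∀ {A B} → A ≃ B → B ≃ A
  ≃-trans : ∀ {A B C} → A ≃ B → B ≃ C → A ≃ C
  ≃-●     : ∀ {A B} → A ≃ B → ● A ≃ ● B
  ≃-⇒     : ∀ {A B C D} → A ≃ C → B ≃ D → A ⇒ B ≃ C ⇒ D
  ≃-⇒𝕋    : ∀ {A} → WF A → A ⇒ 𝕋 ≃ 𝕋
  ≃-unfold : ∀ {A} → WF (μ A) → WF (A [ μ A ]₀) → μ A ≃ A [ μ A ]₀
  ≃-fold  : ∀ {A C} → WF (μ C) → A ≃ C [ A ]₀ → Proper zero C → A ≃ μ C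
  ≃-●⇒    : ∀ {A B} → WF A → WF B → ● (A ⇒ B) ≃ ● A ⇒ ● B

record Frame : Set₁ where
  infix 4 _▷_ _▷*_
  field
    W        : Set
    _▷_      : W → W → Set
    nonempty : W
    -- no infinite chain p0 ▷ p1 ▷ ⋯  (constructively: well-foundedness)
    noChain  : WellFounded (flip _▷_)
  _▷*_ : W → W → Set
  _▷*_ = Star _▷_
  field
    locLin : ∀ {p q} → p ▷ q →
             ∃ λ r → (p ▷* r) × (r ▷ q) × (∀ {s} → r ▷ s → q ▷* s)

module _ (F : Frame) (𝒜 : SynLamAlg) where
  open Frame F
  open SynLamAlg 𝒜

  TypeEnv : Set₁
  TypeEnv = ℕ → W → Pred V 0ℓ

  Hereditary : TypeEnv → Set
  Hereditary η = ∀ X {p q} → p ▷ q → η X p ⊆ η X q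

  -- I satisfies the defining clauses of 𝓘(·)^η on type expressions
  record IsInterpretation (η : TypeEnv) (I : Ty → W → Pred V 0ℓ) : Set₁ where
    field
      I-top : ∀ A p → WF A → IsTopVariant A → I A p ≐ U
      I-var : ∀ X p → ¬ IsTopVariant (tvar X) → I (tvar X) p ≐ η X p
      I-●   : ∀ A p → WF A → ¬ IsTopVariant (● A) →
              I (● A) p ≐ (λ u → ∀ q → p ▷ q → u ∈ I A q)
      I-⇒   : ∀ A B p → WF A → WF B → ¬ IsTopVariant (A ⇒ B) →
              I (A ⇒ B) p ≐
                (λ u → ∀ q → p ▷* q → ∀ v → v ∈ I A q → u ∙ v ∈ I B q)
      I-μ   : ∀ A p → WF (μ A) → ¬ IsTopVariant (μ A) →
              I (μ A) p ≐ I (A [ μ A ]₀) p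

module Submission where

-- The interpretation I is only known through its defining clauses, each of
-- which applies to non-⊤-variants.
--     Two guarded substitution lemmas follow by world induction plus
--     structural induction on C: an instance C[σ] is hereditary (3a), resp.
--     C[σ₁] and C[σ₂] agree at q (3b), as soon as the substituted types are
--     so at all strictly later worlds, and at q itself on the variables in
--     which C is not proper.  Properness makes the μ-case go through.
--  4. Soundness, by induction on the derivation of A ≃ B.  The fold rule
--     (unique guarded fixed points) is 3b plus world induction; the rule
--     ●(A ⇒ B) ≃ ●A ⇒ ●B uses heredity (3a) and local linearity of the frame.

open import Defs
open import Level using (0ℓ)
open import Relation.Unary using (Pred; _≐_; _∈_)
open import Relation.Unary.Properties using (≐-refl; ≐-sym; ≐-trans)
open import Data.Nat using (ℕ; zero; suc; _<_; z≤n; s≤s)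
open import Data.Nat.Properties using (suc-injective)
open import Data.Bool using (Bool; true; false)
open import Data.List using (List; []; _∷_; map; length; _++_)
open import Data.List.Properties using (length-map; map-++)
open import Data.Product using (Σ; _×_; _,_; proj₁; proj₂)
open import Data.Sum using (_⊎_; inj₁; inj₂)
open import Data.Unit using (tt)
open import Data.Empty using (⊥-elim)
open import Function using (_∘_; const; flip)
open import Relation.Nullary using (¬_; Dec; yes; no)
open import Relation.Binary.PropositionalEquality
  using (_≡_; _≗_; refl; sym; trans; cong; cong₂)
  renaming (subst to transport)
open import Relation.Binary.Construct.Closure.ReflexiveTransitive using (ε; _◅_; _◅◅_)
open import Induction.WellFounded using (Acc; acc)

ext-cong : ∀ {ρ ρ′} → ρ ≗ ρ′ → ext ρ ≗ ext ρ′
ext-cong e zero    = refl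
ext-cong e (suc x) = cong suc (e x)

ren-cong : ∀ {ρ ρ′} → ρ ≗ ρ′ → ∀ A → ren ρ A ≡ ren ρ′ A
ren-cong e (tvar x) = cong tvar (e x)
ren-cong e (A ⇒ B)  = cong₂ _⇒_ (ren-cong e A) (ren-cong e B)
ren-cong e (● A)    = cong ●_ (ren-cong e A)
ren-cong e (μ A)    = cong μ_ (ren-cong (ext-cong e) A)

exts-cong : ∀ {σ σ′} → σ ≗ σ′ → exts σ ≗ exts σ′
exts-cong e zero    = refl
exts-cong e (suc x) = cong (ren suc) (e x)

subst-cong : ∀ {σ σ′} → σ ≗ σ′ → ∀ A → subst σ A ≡ subst σ′ A
subst-cong e (tvar x) = e x
subst-cong e (A ⇒ B)  = cong₂ _⇒_ (subst-cong e A) (subst-cong e B)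
subst-cong e (● A)    = cong ●_ (subst-cong e A)
subst-cong e (μ A)    = cong μ_ (subst-cong (exts-cong e) A)

ren-ren : ∀ ρ ρ′ A → ren ρ (ren ρ′ A) ≡ ren (ρ ∘ ρ′) A
ren-ren ρ ρ′ (tvar x) = refl
ren-ren ρ ρ′ (A ⇒ B)  = cong₂ _⇒_ (ren-ren ρ ρ′ A) (ren-ren ρ ρ′ B)
ren-ren ρ ρ′ (● A)    = cong ●_ (ren-ren ρ ρ′ A)
ren-ren ρ ρ′ (μ A)    = cong μ_ (trans (ren-ren (ext ρ) (ext ρ′) A) (ren-cong ext-∘ A))
  where ext-∘ : ext ρ ∘ ext ρ′ ≗ ext (ρ ∘ ρ′)
        ext-∘ zero    = refl
        ext-∘ (suc x) = refl

subst-ren : ∀ σ ρ A → subst σ (ren ρ A) ≡ subst (σ ∘ ρ) A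
subst-ren σ ρ (tvar x) = refl
subst-ren σ ρ (A ⇒ B)  = cong₂ _⇒_ (subst-ren σ ρ A) (subst-ren σ ρ B)
subst-ren σ ρ (● A)    = cong ●_ (subst-ren σ ρ A)
subst-ren σ ρ (μ A)    = cong μ_ (trans (subst-ren (exts σ) (ext ρ) A) (subst-cong exts-∘ A))
  where exts-∘ : exts σ ∘ ext ρ ≗ exts (σ ∘ ρ)
        exts-∘ zero    = refl
        exts-∘ (suc x) = refl

ren-subst : ∀ ρ σ A → ren ρ (subst σ A) ≡ subst (ren ρ ∘ σ) A
ren-subst ρ σ (tvar x) = refl
ren-subst ρ σ (A ⇒ B)  = cong₂ _⇒_ (ren-subst ρ σ A) (ren-subst ρ σ B)
ren-subst ρ σ (● A)    = cong ●_ (ren-subst ρ σ A)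
ren-subst ρ σ (μ A)    = cong μ_ (trans (ren-subst (ext ρ) (exts σ) A) (subst-cong ext-exts A))
  where ext-exts : ren (ext ρ) ∘ exts σ ≗ exts (ren ρ ∘ σ)
        ext-exts zero    = refl
        ext-exts (suc x) = trans (ren-ren (ext ρ) suc (σ x)) (sym (ren-ren suc ρ (σ x)))

subst-subst : ∀ σ τ A → subst σ (subst τ A) ≡ subst (subst σ ∘ τ) A
subst-subst σ τ (tvar x) = refl
subst-subst σ τ (A ⇒ B)  = cong₂ _⇒_ (subst-subst σ τ A) (subst-subst σ τ B)
subst-subst σ τ (● A)    = cong ●_ (subst-subst σ τ A)
subst-subst σ τ (μ A)    = cong μ_ (trans (subst-subst (exts σ) (exts τ) A) (subst-cong exts-∘ A))
  where exts-∘ : subst (exts σ) ∘ exts τ ≗ exts (subst σ ∘ τ)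
        exts-∘ zero    = refl
        exts-∘ (suc x) = trans (subst-ren (exts σ) suc (τ x)) (sym (ren-subst suc σ (τ x)))

subst-id : ∀ A → subst tvar A ≡ A
subst-id (tvar x) = refl
subst-id (A ⇒ B)  = cong₂ _⇒_ (subst-id A) (subst-id B)
subst-id (● A)    = cong ●_ (subst-id A)
subst-id (μ A)    = cong μ_ (trans (subst-cong exts-id A) (subst-id A))
  where exts-id : exts tvar ≗ tvar
        exts-id zero    = refl
        exts-id (suc x) = refl

_∷ˢ_ : Ty → (ℕ → Ty) → ℕ → Ty
(M ∷ˢ σ) zero    = M
(M ∷ˢ σ) (suc n) = σ n

subst-unfold : ∀ σ D →
  subst (exts σ) D [ subst σ (μ D) ]₀ ≡ subst (subst σ (μ D) ∷ˢ σ) D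
subst-unfold σ D = trans (subst-subst _ (exts σ) D) (subst-cong unfold-∘ D)
  where unfold-∘ : subst (σ₀ (subst σ (μ D))) ∘ exts σ ≗ subst σ (μ D) ∷ˢ σ
        unfold-∘ zero    = refl
        unfold-∘ (suc x) = trans (subst-ren _ suc (σ x)) (subst-id (σ x))

-- 1b. ⊤-variants

tail-ren : ∀ ρ A → tail (ren ρ A) ≡ ren ρ (tail A)
tail-ren ρ (tvar x) = refl
tail-ren ρ (A ⇒ B)  = tail-ren ρ B
tail-ren ρ (● A)    = cong ●_ (tail-ren ρ A)
tail-ren ρ (μ A)    = cong μ_ (tail-ren (ext ρ) A)

tail-subst : ∀ σ A → tail (subst σ A) ≡ subst (tail ∘ σ) (tail A)
tail-subst σ (tvar x) = refl
tail-subst σ (A ⇒ B)  = tail-subst σ B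
tail-subst σ (● A)    = cong ●_ (tail-subst σ A)
tail-subst σ (μ A)    =
  cong μ_ (trans (tail-subst (exts σ) A) (subst-cong tail-exts (tail A)))
  where tail-exts : tail ∘ exts σ ≗ exts (tail ∘ σ)
        tail-exts zero    = refl
        tail-exts (suc n) = tail-ren suc (σ n)

-- Passing under a •: every enclosing binder is now followed by a •.
marked-all : List Bool → List Bool
marked-all = map (const true)

marked-bound : ∀ {bs k} → Marked bs k → k < length bs
marked-bound here      = s≤s z≤n
marked-bound (there m) = s≤s (marked-bound m)

bound-marked-all : ∀ {bs k} → k < length bs → Marked (marked-all bs) k
bound-marked-all {_ ∷ _} {zero}  _       = here
bound-marked-all {_ ∷ _} {suc k} (s≤s l) = there (bound-marked-all l)

<-length-marked-all : ∀ {k} bs → k < length (marked-all bs) → k < length bs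
<-length-marked-all bs = transport (_ <_) (length-map (const true) bs)

<-length-marked-all⁻ : ∀ {k} bs → k < length bs → k < length (marked-all bs)
<-length-marked-all⁻ bs = transport (_ <_) (sym (length-map (const true) bs))

marked-++ : ∀ {bs k} cs → Marked bs k → Marked (bs ++ cs) k
marked-++ cs here      = here
marked-++ cs (there m) = there (marked-++ cs m)

shape-weaken : ∀ {bs T} → TopShape bs T → ∀ cs → TopShape (bs ++ cs) T
shape-weaken (ts-var m) cs = ts-var (marked-++ cs m)
shape-weaken {bs} (ts-● t) cs =
  ts-● (transport (λ l → TopShape l _) (sym (map-++ (const true) bs cs))
                  (shape-weaken t (marked-all cs)))
shape-weaken (ts-μ t) cs = ts-μ (shape-weaken t cs)

shape-ren : ∀ {bs T ρ} → TopShape bs T → (∀ k → k < length bs → ρ k ≡ k) →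
            TopShape bs (ren ρ T)
shape-ren {bs} {tvar k} (ts-var m) fix =
  transport (λ j → TopShape bs (tvar j)) (sym (fix k (marked-bound m))) (ts-var m)
shape-ren {bs} (ts-● t) fix = ts-● (shape-ren t (λ k l → fix k (<-length-marked-all bs l)))
shape-ren {bs} {μ A} {ρ} (ts-μ t) fix = ts-μ (shape-ren t fix′)
  where fix′ : ∀ k → k < suc (length bs) → ext ρ k ≡ k
        fix′ zero    _       = refl
        fix′ (suc k) (s≤s l) = cong suc (fix k l)

-- σ sends the binders bs to the binders bs′ compatibly with shapes: each
-- bound variable goes to a closed ⊤-shape or to a bound variable of bs′
-- whose binder is marked whenever the original one was.
ShapeMap : List Bool → List Bool → (ℕ → Ty) → Set
ShapeMap bs bs′ σ = ∀ k → k < length bs →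
  TopShape [] (σ k) ⊎
  Σ ℕ (λ j → (σ k ≡ tvar j) × (Marked bs k → Marked bs′ j) × (j < length bs′))

shape-subst : ∀ {bs bs′ T σ} → TopShape bs T → ShapeMap bs bs′ σ →
              TopShape bs′ (subst σ T)
shape-subst {bs} {bs′} {tvar k} (ts-var m) c with c k (marked-bound m)
... | inj₁ t                = shape-weaken t bs′
... | inj₂ (j , eq , f , _) = transport (TopShape bs′) (sym eq) (ts-var (f m))
shape-subst {bs} {bs′} {● A} {σ} (ts-● t) c = ts-● (shape-subst t c′)
  where c′ : ShapeMap (marked-all bs) (marked-all bs′) σ
        c′ k l with c k (<-length-marked-all bs l)
        ... | inj₁ t                = inj₁ t
        ... | inj₂ (j , eq , _ , l′) =
          inj₂ (j , eq , (λ _ → bound-marked-all l′) , <-length-marked-all⁻ bs′ l′)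
shape-subst {bs} {bs′} {μ A} {σ} (ts-μ t) c = ts-μ (shape-subst t c′)
  where c′ : ShapeMap (false ∷ bs) (false ∷ bs′) (exts σ)
        c′ zero    _ = inj₂ (zero , refl , (λ ()) , s≤s z≤n)
        c′ (suc k) (s≤s l) with c k l
        ... | inj₁ t                = inj₁ (shape-ren t (λ _ ()))
        ... | inj₂ (j , eq , f , l′) =
          inj₂ (suc j , cong (ren suc) eq , (λ { (there m) → there (f m) }) , s≤s l′)

-- ⊤-variants are closed, hence stable under renaming and substitution.
top-ren : ∀ ρ B → IsTopVariant B → IsTopVariant (ren ρ B)
top-ren ρ B t = transport (TopShape []) (sym (tail-ren ρ B)) (shape-ren t (λ _ ()))

top-subst : ∀ σ B → IsTopVariant B → IsTopVariant (subst σ B)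
top-subst σ B t = transport (TopShape []) (sym (tail-subst σ B)) (shape-subst t (λ _ ()))

-- Unfolding a ⊤-variant μA gives a ⊤-variant: in the tail, the bound
-- variable is replaced by the closed ⊤-shape tail (μA).
top-unfold : ∀ A → IsTopVariant (μ A) → IsTopVariant (A [ μ A ]₀)
top-unfold A (ts-μ t) =
  transport (TopShape []) (sym (tail-subst (σ₀ (μ A)) A)) (shape-subst t unfold-map)
  where unfold-map : ShapeMap (false ∷ []) [] (tail ∘ σ₀ (μ A))
        unfold-map zero    _         = inj₁ (ts-μ t)
        unfold-map (suc k) (s≤s ())

top-𝕋 : IsTopVariant 𝕋
top-𝕋 = ts-μ (ts-● (ts-var here))

¬top-var : ∀ x → ¬ IsTopVariant (tvar x)
¬top-var x (ts-var ())

marked? : ∀ bs k → Dec (Marked bs k)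
marked? []           k       = no (λ ())
marked? (true ∷ bs)  zero    = yes here
marked? (false ∷ bs) zero    = no (λ ())
marked? (b ∷ bs)     (suc k) with marked? bs k
... | yes m  = yes (there m)
... | no ¬m  = no (λ { (there m) → ¬m m })

top-shape? : ∀ bs T → Dec (TopShape bs T)
top-shape? bs (tvar k) with marked? bs k
... | yes m = yes (ts-var m)
... | no ¬m = no (λ { (ts-var m) → ¬m m })
top-shape? bs (A ⇒ B) = no (λ ())
top-shape? bs (● A) with top-shape? (marked-all bs) A
... | yes t = yes (ts-● t)
... | no ¬t = no (λ { (ts-● t) → ¬t t })
top-shape? bs (μ A) with top-shape? (false ∷ bs) A
... | yes t = yes (ts-μ t)
... | no ¬t = no (λ { (ts-μ t) → ¬t t })

top? : ∀ A → Dec (IsTopVariant A)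
top? A = top-shape? [] (tail A)

proper-ren : ∀ {x x′ ρ} A → Proper x A → (∀ y → ¬ y ≡ x → ¬ ρ y ≡ x′) →
             Proper x′ (ren ρ A)
proper-ren (tvar y) p c = c y p
proper-ren (A ⇒ B) (inj₁ (a , b)) c = inj₁ (proper-ren A a c , proper-ren B b c)
proper-ren {ρ = ρ} (A ⇒ B) (inj₂ t) c = inj₂ (top-ren ρ B t)
proper-ren (● A) _ _ = tt
proper-ren {x} {x′} {ρ} (μ A) (inj₁ a) c = inj₁ (proper-ren A a c′)
  where c′ : ∀ y → ¬ y ≡ suc x → ¬ ext ρ y ≡ suc x′
        c′ zero    _  ()
        c′ (suc y) ne eq = c y (ne ∘ cong suc) (suc-injective eq)
proper-ren {ρ = ρ} (μ A) (inj₂ t) c = inj₂ (top-ren ρ (μ A) t)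

proper-ren-fresh : ∀ {x′ ρ} A → (∀ y → ¬ ρ y ≡ x′) → Proper x′ (ren ρ A)
proper-ren-fresh (tvar y) c = c y
proper-ren-fresh (A ⇒ B)  c = inj₁ (proper-ren-fresh A c , proper-ren-fresh B c)
proper-ren-fresh (● A)    c = tt
proper-ren-fresh {x′} {ρ} (μ A) c = inj₁ (proper-ren-fresh A c′)
  where c′ : ∀ y → ¬ ext ρ y ≡ suc x′
        c′ zero    ()
        c′ (suc y) eq = c y (suc-injective eq)

proper-subst : ∀ {x x′ σ} A → Proper x A → (∀ y → ¬ y ≡ x → Proper x′ (σ y)) →
               Proper x′ (subst σ A)
proper-subst (tvar y) p c = c y p
proper-subst (A ⇒ B) (inj₁ (a , b)) c = inj₁ (proper-subst A a c , proper-subst B b c)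
proper-subst {σ = σ} (A ⇒ B) (inj₂ t) c = inj₂ (top-subst σ B t)
proper-subst (● A) _ _ = tt
proper-subst {x} {x′} {σ} (μ A) (inj₁ a) c = inj₁ (proper-subst A a c′)
  where c′ : ∀ y → ¬ y ≡ suc x → Proper (suc x′) (exts σ y)
        c′ zero    _  ()
        c′ (suc y) ne = proper-ren (σ y) (c y (ne ∘ cong suc)) (λ z ne′ → ne′ ∘ suc-injective)
proper-subst {σ = σ} (μ A) (inj₂ t) c = inj₂ (top-subst σ (μ A) t)

WFˢ : (ℕ → Ty) → Set
WFˢ σ = ∀ y → WF (σ y)

WF-ren : ∀ ρ A → WF A → WF (ren ρ A)
WF-ren ρ (tvar x) _       = tt
WF-ren ρ (A ⇒ B)  (a , b) = WF-ren ρ A a , WF-ren ρ B b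
WF-ren ρ (● A)    w       = WF-ren ρ A w
WF-ren ρ (μ A)    (p , w) = proper-ren A p ext-avoids-0 , WF-ren (ext ρ) A w
  where ext-avoids-0 : ∀ y → ¬ y ≡ zero → ¬ ext ρ y ≡ zero
        ext-avoids-0 zero    ne _ = ne refl
        ext-avoids-0 (suc y) _  ()

WF-subst : ∀ σ A → WF A → WFˢ σ → WF (subst σ A)
WF-subst σ (tvar x) _       ws = ws x
WF-subst σ (A ⇒ B)  (a , b) ws = WF-subst σ A a ws , WF-subst σ B b ws
WF-subst σ (● A)    w       ws = WF-subst σ A w ws
WF-subst σ (μ A)    (p , w) ws = proper-subst A p exts-proper , WF-subst (exts σ) A w exts-WF
  where exts-proper : ∀ y → ¬ y ≡ zero → Proper zero (exts σ y)
        exts-proper zero    ne = ⊥-elim (ne refl)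
        exts-proper (suc y) _  = proper-ren-fresh (σ y) (λ _ ())
        exts-WF : WFˢ (exts σ)
        exts-WF zero    = tt
        exts-WF (suc y) = WF-ren suc (σ y) (ws y)

WF-σ₀ : ∀ {M} → WF M → WFˢ (σ₀ M)
WF-σ₀ w zero    = w
WF-σ₀ w (suc y) = tt

WF-∷ˢ : ∀ {M σ} → WF M → WFˢ σ → WFˢ (M ∷ˢ σ)
WF-∷ˢ w ws zero    = w
WF-∷ˢ w ws (suc y) = ws y

WF-unfold : ∀ A → WF (μ A) → WF (A [ μ A ]₀)
WF-unfold A w = WF-subst (σ₀ (μ A)) A (proj₂ w) (WF-σ₀ w)

WF-≃ : ∀ {A B} → A ≃ B → WF A × WF B
WF-≃ (≃-refl w)       = w , w
WF-≃ (≃-sym e)        = proj₂ (WF-≃ e) , proj₁ (WF-≃ e)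
WF-≃ (≃-trans e f)    = proj₁ (WF-≃ e) , proj₂ (WF-≃ f)
WF-≃ (≃-● e)          = WF-≃ e
WF-≃ (≃-⇒ e f)        = (proj₁ (WF-≃ e) , proj₁ (WF-≃ f)) , (proj₂ (WF-≃ e) , proj₂ (WF-≃ f))
WF-≃ (≃-⇒𝕋 w)         = (w , tt , tt) , (tt , tt)
WF-≃ (≃-unfold w w′)  = w , w′
WF-≃ (≃-fold w e _)   = proj₁ (WF-≃ e) , w
WF-≃ (≃-●⇒ a b)       = (a , b) , (a , b)

module FrameFacts (F : Frame) where
  open Frame F

  After : W → (W → Set) → Set
  After q P = ∀ r → q ▷ r → ∀ s → r ▷* s → P s

  world-ind : (P : W → Set) → (∀ q → After q P → P q) → ∀ q → P q
  world-ind P step q = go q (noChain q) q ε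
    where
      go : ∀ q → Acc (flip _▷_) q → ∀ s → q ▷* s → P s
      go q (acc rs) s ε         = step q (λ r qr s′ rs′ → go r (rs qr) s′ rs′)
      go q (acc rs) s (qr ◅ rs′) = go _ (rs qr) s rs′

  after-star : ∀ {P q r s} → After q P → q ▷ r → r ▷* s → After s P × P s
  after-star L qr rs = (λ r′ sr′ t r′t → L _ qr t (rs ◅◅ (sr′ ◅ r′t))) , L _ qr _ rs

  after-step : ∀ {P q r} → After q P → q ▷ r → After r P × P r
  after-step L qr = after-star L qr ε

  first-step : ∀ {p q s} → p ▷* q → q ▷ s → Σ W (λ q′ → (p ▷ q′) × (q′ ▷* s))
  first-step ε          qs = _ , qs , ε
  first-step (pp′ ◅ p′q) qs = _ , pp′ , (p′q ◅◅ (qs ◅ ε))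

  last-step : ∀ {p q r} → p ▷ q → q ▷* r → Σ W (λ r′ → (p ▷* r′) × (r′ ▷ r))
  last-step pq ε = _ , ε , pq
  last-step pq (qq′ ◅ q′r) with last-step qq′ q′r
  ... | r′ , pr′ , r′r = r′ , (pq ◅ pr′) , r′r

module Semantics (F : Frame) (𝒜 : SynLamAlg) (η : TypeEnv F 𝒜) (η-her : Hereditary F 𝒜 η)
  (I : Ty → Frame.W F → Pred (SynLamAlg.V 𝒜) 0ℓ) (isI : IsInterpretation F 𝒜 η I) where

  open Frame F
  open SynLamAlg 𝒜
  open IsInterpretation isI
  open FrameFacts F

  Box : (W → Pred V 0ℓ) → W → Pred V 0ℓ
  Box X p u = ∀ q → p ▷ q → u ∈ X q

  Arr : (W → Pred V 0ℓ) → (W → Pred V 0ℓ) → W → Pred V 0ℓ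
  Arr X Y p u = ∀ q → p ▷* q → ∀ v → v ∈ X q → u ∙ v ∈ Y q

  Agree : W → Ty → Ty → Set
  Agree s T₁ T₂ = I T₁ s ≐ I T₂ s

  agree-≡ : ∀ {T T′} s → T ≡ T′ → Agree s T T′
  agree-≡ s refl = ≐-refl

  I-full : ∀ A p → WF A → IsTopVariant A → ∀ {u} → u ∈ I A p
  I-full A p w t = proj₂ (I-top A p w t) tt

  agree-top : ∀ {A B p} → WF A → WF B → IsTopVariant A → IsTopVariant B → Agree p A B
  agree-top {A} {B} {p} wa wb ta tb = (λ _ → I-full B p wb tb) , (λ _ → I-full A p wa ta)

  -- The defining clauses hold unconditionally on type expressions: for
  -- ⊤-variants both sides are the whole carrier.
  I-●′ : ∀ A p → WF A → I (● A) p ≐ Box (I A) p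
  I-●′ A p w with top? (● A)
  ... | yes (ts-● t) = (λ _ q _ → I-full A q w t) , (λ _ → I-full (● A) p w (ts-● t))
  ... | no ¬t        = I-● A p w ¬t

  I-⇒′ : ∀ A B p → WF A → WF B → I (A ⇒ B) p ≐ Arr (I A) (I B) p
  I-⇒′ A B p wa wb with top? B
  ... | yes t = (λ _ q _ v _ → I-full B q wb t) , (λ _ → I-full (A ⇒ B) p (wa , wb) t)
  ... | no ¬t = I-⇒ A B p wa wb ¬t

  I-μ′ : ∀ A p → WF (μ A) → Agree p (μ A) (A [ μ A ]₀)
  I-μ′ A p w with top? (μ A)
  ... | yes t = agree-top w (WF-unfold A w) t (top-unfold A t)
  ... | no ¬t = I-μ A p w ¬t

  I-var′ : ∀ X p → I (tvar X) p ≐ η X p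
  I-var′ X p = I-var X p (¬top-var X)

  I-μ-subst : ∀ σ D p → WF (μ D) → WFˢ σ →
              Agree p (subst σ (μ D)) (subst (subst σ (μ D) ∷ˢ σ) D)
  I-μ-subst σ D p w ws =
    ≐-trans (I-μ′ (subst (exts σ) D) p (WF-subst σ (μ D) w ws)) (agree-≡ p (subst-unfold σ D))

  Box-cong : ∀ {X Y q} → (∀ r → q ▷ r → X r ≐ Y r) → Box X q ≐ Box Y q
  Box-cong e = (λ x r qr → proj₁ (e r qr) (x r qr)) , (λ x r qr → proj₂ (e r qr) (x r qr))

  Arr-cong : ∀ {X₁ X₂ Y₁ Y₂ q} →
             (∀ s → q ▷* s → X₁ s ≐ X₂ s) → (∀ s → q ▷* s → Y₁ s ≐ Y₂ s) →
             Arr X₁ Y₁ q ≐ Arr X₂ Y₂ q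
  Arr-cong ex ey = (λ x s qs v vx → proj₁ (ey s qs) (x s qs v (proj₂ (ex s qs) vx)))
                 , (λ x s qs v vx → proj₂ (ey s qs) (x s qs v (proj₁ (ex s qs) vx)))

  agree-● : ∀ {A B p} → WF A × WF B → (∀ r → p ▷ r → Agree r A B) → Agree p (● A) (● B)
  agree-● {A} {B} {p} (wa , wb) e =
    ≐-trans (I-●′ A p wa) (≐-trans (Box-cong e) (≐-sym (I-●′ B p wb)))

  agree-⇒ : ∀ {A B C D p} → WF A × WF C → WF B × WF D →
            (∀ s → p ▷* s → Agree s A C) → (∀ s → p ▷* s → Agree s B D) →
            Agree p (A ⇒ B) (C ⇒ D)
  agree-⇒ {A} {B} {C} {D} {p} (wa , wc) (wb , wd) e f =
    ≐-trans (I-⇒′ A B p wa wb) (≐-trans (Arr-cong e f) (≐-sym (I-⇒′ C D p wc wd)))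

  -- The family P y s describes what is known
  -- about the value of the variable y at world s; it is guaranteed at all
  -- later worlds, and at q itself unless C is proper in y.

  Guarded : (ℕ → W → Set) → W → Ty → Set
  Guarded P q C = ∀ y → After q (P y) × (Proper y C ⊎ P y q)

  guarded-later : ∀ {P q r s C C′} → Guarded P q C → q ▷ r → r ▷* s → Guarded P s C′
  guarded-later G qr rs y = let (L′ , h) = after-star (proj₁ (G y)) qr rs in L′ , inj₂ h

  guarded-⇒ : ∀ {P q C₁ C₂} → ¬ IsTopVariant C₂ → Guarded P q (C₁ ⇒ C₂) →
              Guarded P q C₁ × Guarded P q C₂
  guarded-⇒ {P} {q} {C₁} {C₂} ¬t G = component proj₁ , component proj₂
    where
      component : ∀ {C} → (∀ {y} → Proper y C₁ × Proper y C₂ → Proper y C) → Guarded P q C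
      component pr y with G y
      ... | L , inj₁ (inj₁ p) = L , inj₁ (pr p)
      ... | L , inj₁ (inj₂ t) = ⊥-elim (¬t t)
      ... | L , inj₂ h        = L , inj₂ h

  guarded-μ : ∀ {P Q : ℕ → W → Set} {q D} → ¬ IsTopVariant (μ D) → Proper zero D →
              Guarded P q (μ D) → After q (Q zero) → (∀ {y s} → P y s → Q (suc y) s) →
              Guarded Q q D
  guarded-μ ¬t pr G L₀ shift zero = L₀ , inj₁ pr
  guarded-μ ¬t pr G L₀ shift (suc y) with G y
  ... | L , inj₁ (inj₁ p) = (λ r qr s rs → shift (L r qr s rs)) , inj₁ p
  ... | L , inj₁ (inj₂ t) = ⊥-elim (¬t t)
  ... | L , inj₂ h        = (λ r qr s rs → shift (L r qr s rs)) , inj₂ (shift h)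

  guarded-var : ∀ {P q y} → Guarded P q (tvar y) → P y q
  guarded-var {y = y} G with G y
  ... | _ , inj₁ ¬y≡y = ⊥-elim (¬y≡y refl)
  ... | _ , inj₂ h    = h

  -- 3a. Heredity: I T q ⊆ I T r whenever q ▷ r.

  Her : W → Ty → Set
  Her q T = ∀ r → q ▷ r → ∀ {u} → u ∈ I T q → u ∈ I T r

  her-≐ : ∀ {q T T′} → (∀ s → Agree s T T′) → Her q T → Her q T′
  her-≐ {q} e h r qr x = proj₁ (e r) (h r qr (proj₂ (e q) x))

  -- Arrow types are hereditary outright, by transitivity of ▷*.
  her-⇒ : ∀ A B q → WF A → WF B → Her q (A ⇒ B)
  her-⇒ A B q wa wb r qr x =
    proj₂ (I-⇒′ A B r wa wb) (λ s rs → proj₁ (I-⇒′ A B q wa wb) x s (qr ◅ rs))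

  her-● : ∀ A q → WF A → (∀ r → q ▷ r → Her r A) → Her q (● A)
  her-● A q w h r qr x =
    proj₂ (I-●′ A r w) (λ s rs → h r qr s rs (proj₁ (I-●′ A q w) x r qr))

  HerInst : W → Set
  HerInst q = ∀ C σ → WF C → WFˢ σ → Guarded (λ y s → Her s (σ y)) q C → Her q (subst σ C)

  her-inst-step : ∀ q → After q HerInst → HerInst q
  her-inst-step q L (tvar y) σ w ws G = guarded-var G
  her-inst-step q L (C₁ ⇒ C₂) σ (w₁ , w₂) ws G =
    her-⇒ (subst σ C₁) (subst σ C₂) q (WF-subst σ C₁ w₁ ws) (WF-subst σ C₂ w₂ ws)
  her-inst-step q L (● C) σ w ws G = her-● (subst σ C) q (WF-subst σ C w ws)
    (λ r qr → proj₂ (after-step L qr) C σ w ws (guarded-later {C = ● C} G qr ε))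
  her-inst-step q L (μ D) σ w ws G with top? (μ D)
  ... | yes t = λ r _ _ →
    I-full (subst σ (μ D)) r (WF-subst σ (μ D) w ws) (top-subst σ (μ D) t)
  ... | no ¬t = her-≐ (λ s → ≐-sym (I-μ-subst σ D s w ws))
                  (her-inst-step q L D τ (proj₂ w) (WF-∷ˢ (WF-subst σ (μ D) w ws) ws)
                    (guarded-μ ¬t (proj₁ w) G later-μ (λ h → h)))
    where
      τ : ℕ → Ty
      τ = subst σ (μ D) ∷ˢ σ
      later-μ : After q (λ s → Her s (subst σ (μ D)))
      later-μ r qr s rs =
        L r qr s rs (μ D) σ w ws (guarded-later {C = μ D} {C′ = μ D} G qr rs)

  her-var : ∀ q y → Her q (tvar y)
  her-var q y r qr x = proj₂ (I-var′ y r) (η-her y qr (proj₁ (I-var′ y q) x))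

  -- Every type expression is hereditary: take σ the identity substitution.
  her : ∀ A → WF A → ∀ q → Her q A
  her A w q = transport (Her q) (subst-id A)
    (world-ind HerInst her-inst-step q A tvar w (λ _ → tt)
      (λ y → (λ _ _ s _ → her-var s y) , inj₂ (her-var q y)))

  her* : ∀ A → WF A → ∀ {q r} → q ▷* r → ∀ {u} → u ∈ I A q → u ∈ I A r
  her* A w ε         x = x
  her* A w (qr ◅ rs) x = her* A w rs (her A w _ _ qr x)

  -- 3b. Contractiveness: substitutions agreeing at all later worlds, and
  -- now on the unguarded variables of C, give agreeing instances of C.

  AgreeAt : (ℕ → Ty) → (ℕ → Ty) → ℕ → W → Set
  AgreeAt σ₁ σ₂ y s = Agree s (σ₁ y) (σ₂ y)

  AgreeInst : W → Set
  AgreeInst q = ∀ C σ₁ σ₂ → WF C → WFˢ σ₁ → WFˢ σ₂ →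
                Guarded (AgreeAt σ₁ σ₂) q C → Agree q (subst σ₁ C) (subst σ₂ C)

  -- Inductive step; the arrow case needs its components at q and later.
  agree-inst-step : ∀ q → After q AgreeInst → AgreeInst q
  agree-inst-step q L (tvar y) σ₁ σ₂ w ws₁ ws₂ G = guarded-var G
  agree-inst-step q L (● C) σ₁ σ₂ w ws₁ ws₂ G =
    agree-● (WF-subst σ₁ C w ws₁ , WF-subst σ₂ C w ws₂)
      (λ r qr → proj₂ (after-step L qr) C σ₁ σ₂ w ws₁ ws₂ (guarded-later {C = ● C} G qr ε))
  agree-inst-step q L (C₁ ⇒ C₂) σ₁ σ₂ (w₁ , w₂) ws₁ ws₂ G with top? C₂
  ... | yes t = agree-top (WF-subst σ₁ (C₁ ⇒ C₂) (w₁ , w₂) ws₁)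
                          (WF-subst σ₂ (C₁ ⇒ C₂) (w₁ , w₂) ws₂)
                  (top-subst σ₁ (C₁ ⇒ C₂) t) (top-subst σ₂ (C₁ ⇒ C₂) t)
  ... | no ¬t = agree-⇒ (WF-subst σ₁ C₁ w₁ ws₁ , WF-subst σ₂ C₁ w₁ ws₂)
                        (WF-subst σ₁ C₂ w₂ ws₁ , WF-subst σ₂ C₂ w₂ ws₂)
                        (from-now C₁ w₁ (proj₁ (guarded-⇒ ¬t G)))
                        (from-now C₂ w₂ (proj₂ (guarded-⇒ ¬t G)))
    where
      from-now : ∀ C → WF C → Guarded (AgreeAt σ₁ σ₂) q C →
                 ∀ s → q ▷* s → Agree s (subst σ₁ C) (subst σ₂ C)
      from-now C w G′ s ε         = agree-inst-step q L C σ₁ σ₂ w ws₁ ws₂ G′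
      from-now C w G′ s (qr ◅ rs) =
        L _ qr s rs C σ₁ σ₂ w ws₁ ws₂ (guarded-later {C = C₁ ⇒ C₂} G qr rs)
  agree-inst-step q L (μ D) σ₁ σ₂ w ws₁ ws₂ G with top? (μ D)
  ... | yes t = agree-top (WF-subst σ₁ (μ D) w ws₁) (WF-subst σ₂ (μ D) w ws₂)
                  (top-subst σ₁ (μ D) t) (top-subst σ₂ (μ D) t)
  ... | no ¬t =
    ≐-trans (I-μ-subst σ₁ D q w ws₁)
      (≐-trans (agree-inst-step q L D τ₁ τ₂ (proj₂ w)
                  (WF-∷ˢ (WF-subst σ₁ (μ D) w ws₁) ws₁)
                  (WF-∷ˢ (WF-subst σ₂ (μ D) w ws₂) ws₂)
                  (guarded-μ ¬t (proj₁ w) G later-μ (λ h → h)))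
        (≐-sym (I-μ-subst σ₂ D q w ws₂)))
    where
      τ₁ τ₂ : ℕ → Ty
      τ₁ = subst σ₁ (μ D) ∷ˢ σ₁
      τ₂ = subst σ₂ (μ D) ∷ˢ σ₂
      later-μ : After q (λ s → Agree s (subst σ₁ (μ D)) (subst σ₂ (μ D)))
      later-μ r qr s rs =
        L r qr s rs (μ D) σ₁ σ₂ w ws₁ ws₂ (guarded-later {C = μ D} {C′ = μ D} G qr rs)

  agree-inst : ∀ q → AgreeInst q
  agree-inst = world-ind AgreeInst agree-inst-step

  fixed-point-unique : ∀ {A C} → WF (μ C) → WF A → Proper zero C →
                       (∀ s → Agree s A (C [ A ]₀)) → ∀ q → Agree q A (μ C)
  fixed-point-unique {A} {C} w wa pr solves = world-ind (λ s → Agree s A (μ C)) step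
    where
      step : ∀ q → After q (λ s → Agree s A (μ C)) → Agree q A (μ C)
      step q L = ≐-trans (solves q)
        (≐-trans (agree-inst q C (σ₀ A) (σ₀ (μ C)) (proj₂ w) (WF-σ₀ wa) (WF-σ₀ w) G)
          (≐-sym (I-μ′ C q w)))
        where G : Guarded (AgreeAt (σ₀ A) (σ₀ (μ C))) q C
              G zero    = L , inj₁ pr
              G (suc y) = (λ _ _ _ _ → ≐-refl) , inj₂ ≐-refl

  -- Left to right splits off the first step of a path;
  -- right to left needs local linearity to find a world r₁ before r all of
  -- whose successors lie after r, where v ∈ I A r yields v ∈ I (● A) r₁.
  later-distributes-⇒ : ∀ A B p → WF A → WF B → Agree p (● (A ⇒ B)) (● A ⇒ ● B)
  later-distributes-⇒ A B p wa wb = to , from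
    where
      to : ∀ {u} → u ∈ I (● (A ⇒ B)) p → u ∈ I (● A ⇒ ● B) p
      to x = proj₂ (I-⇒′ (● A) (● B) p wa wb) λ q pq v vx →
        proj₂ (I-●′ B q wb) λ s qs →
          let (q′ , pq′ , q′s) = first-step pq qs in
          proj₁ (I-⇒′ A B q′ wa wb) (proj₁ (I-●′ (A ⇒ B) p (wa , wb)) x q′ pq′) s q′s v
            (proj₁ (I-●′ A q wa) vx s qs)
      from : ∀ {u} → u ∈ I (● A ⇒ ● B) p → u ∈ I (● (A ⇒ B)) p
      from {u} x = proj₂ (I-●′ (A ⇒ B) p (wa , wb)) λ q pq →
        proj₂ (I-⇒′ A B q wa wb) λ r qr v vx →
          let (r′ , pr′ , r′r) = last-step pq qr
              (r₁ , r′r₁ , r₁r , after-r) = locLin r′r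
              v-later : v ∈ I (● A) r₁
              v-later = proj₂ (I-●′ A r₁ wa) (λ s r₁s → her* A wa (after-r r₁s) vx)
              uv-later : u ∙ v ∈ I (● B) r₁
              uv-later = proj₁ (I-⇒′ (● A) (● B) p wa wb) x r₁ (pr′ ◅◅ r′r₁) v v-later
          in proj₁ (I-●′ B r₁ wb) uv-later r r₁r

  sound : ∀ {A B} → A ≃ B → ∀ p → Agree p A B
  sound (≃-refl _)     p = ≐-refl
  sound (≃-sym e)      p = ≐-sym (sound e p)
  sound (≃-trans e f)  p = ≐-trans (sound e p) (sound f p)
  sound (≃-● e)        p = agree-● (WF-≃ e) (λ r _ → sound e r)
  sound (≃-⇒ e f)      p = agree-⇒ (WF-≃ e) (WF-≃ f) (λ s _ → sound e s) (λ s _ → sound f s)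
  sound (≃-⇒𝕋 w)       p = agree-top (w , tt , tt) (tt , tt) top-𝕋 top-𝕋
  sound (≃-unfold w _) p = I-μ′ _ p w
  sound (≃-fold w e pr) p = fixed-point-unique w (proj₁ (WF-≃ e)) pr (λ s → sound e s) p
  sound (≃-●⇒ wa wb)   p = later-distributes-⇒ _ _ p wa wb

theorem4p8 : (F : Frame) (𝒜 : SynLamAlg) (η : TypeEnv F 𝒜) → Hereditary F 𝒜 η →
    (I : Ty → Frame.W F → Pred (SynLamAlg.V 𝒜) 0ℓ) → IsInterpretation F 𝒜 η I →
    ∀ {A B} → A ≃ B → ∀ p → I A p ≐ I B p
theorem4p8 F 𝒜 η η-her I isI = Semantics.sound F 𝒜 η η-her I isI
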